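{- If $\vec{B}=(\vec{b}_1;\dots;\vec{b}_k)\in\mathbb{F}_q^{k\times n}$ is an LLL-reduced basis, then \[n\ge\sum_{i=0}^{k-1}\left\lceil\frac{|\vec{b}_1|}{q^i}\right\rceil.\]
   Context: $|\vec{x}|$ Hamming weight. $\pi^\perp_{\{\vec{x}_1,\dots,\vec{x}_m\}}$ zeroes coordinates in the union of supports; $\pi_i:=\pi^\perp_{\{\vec{b}_1,\dots,\vec{b}_{i-1}\}}$, $\vec{b}_i^+:=\pi_i(\vec{b}_i)$, $\vec{B}_{[i,j]}:=(\pi_i(\vec{b}_i);\dots;\pi_i(\vec{b}_j))$, with $\vec{B}_{[i,j]}:=\vec{B}_{[i,k]}$ for $j>k$. Forward reduced: first vector is a shortest nonzero codeword of the generated code. LLL-reduced: $\vec{B}_{[i,i+1]}$ forward reduced for all $i\in[1,k]$. -}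

module Defs where

open import Level using (Level; _⊔_) renaming (suc to lsuc)
open import Data.Nat using (ℕ; zero; suc; _+_; _^_; _≤_; _<_)
open import Data.Nat.DivMod using (_/_)
open import Data.Bool using (Bool; true; false; _∨_; if_then_else_)
open import Data.Fin using (Fin; toℕ) renaming (zero to fzero; suc to fsuc)
open import Data.Product using (∃-syntax; _×_)
open import Data.List using (map; upTo)
open import Data.Nat.ListAction using (sum)
open import Relation.Nullary using (¬_; Dec; yes; no)
open import Relation.Binary.PropositionalEquality using (_≡_)
open import Algebra.Bundles using (CommutativeRing)

-- Ceiling division ⌈a / b⌉ (the value for b = 0 is irrelevant: it is only
-- used with b = q ^ i ≥ 1).
⌈_/_⌉ : ℕ → ℕ → ℕ
⌈ a / zero ⌉  = 0
⌈ a / suc b ⌉ = (a + b) / suc b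

record FiniteField (c ℓ : Level) (q : ℕ) : Set (lsuc (c ⊔ ℓ)) where
  field
    commRing : CommutativeRing c ℓ
  open CommutativeRing commRing public
  field
    0≉1       : ¬ (0# ≈ 1#)
    inverse   : ∀ x → ¬ (x ≈ 0#) → ∃[ y ] (x * y ≈ 1#)
    _≟_       : ∀ x y → Dec (x ≈ y)
    enum      : Fin q → Carrier
    enum-surj : ∀ x → ∃[ i ] (enum i ≈ x)
    enum-inj  : ∀ i j → enum i ≈ enum j → i ≡ j

module Code {c ℓ q} (F : FiniteField c ℓ q) where
  open FiniteField F
    using (Carrier; _≈_; 0#; _≟_)
    renaming (_+_ to _+F_; _*_ to _*F_)

  Word : ℕ → Set c
  Word n = Fin n → Carrier

  -- a k × n matrix, given by its rows b_1..b_k (row r : Fin k is b_{r+1})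
  Matrix : ℕ → ℕ → Set c
  Matrix k n = Fin k → Word n

  isNonzero : Carrier → Bool
  isNonzero a with a ≟ 0#
  ... | yes _ = false
  ... | no  _ = true

  count : ∀ {n} → (Fin n → Bool) → ℕ
  count {zero}  f = 0
  count {suc n} f = (if f fzero then 1 else 0) + count (λ i → f (fsuc i))

  ∣_∣ₕ : ∀ {n} → Word n → ℕ
  ∣ x ∣ₕ = count (λ j → isNonzero (x j))

  NonzeroWord : ∀ {n} → Word n → Set ℓ
  NonzeroWord x = ∃[ j ] ¬ (x j ≈ 0#)

  ∑ : ∀ {m} → (Fin m → Carrier) → Carrier
  ∑ {zero}  f = 0#
  ∑ {suc m} f = f fzero +F ∑ (λ i → f (fsuc i))

  lincomb : ∀ {m n} → Matrix m n → (Fin m → Carrier) → Word n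
  lincomb rows cs j = ∑ (λ r → cs r *F rows r j)

  LinIndep : ∀ {m n} → Matrix m n → Set (c ⊔ ℓ)
  LinIndep rows = ∀ cs → (∀ j → lincomb rows cs j ≈ 0#) → ∀ r → cs r ≈ 0#

  inSupp : ∀ {k n} → Matrix k n → ℕ → Fin n → Bool
  inSupp {zero}  B i       j = false
  inSupp {suc k} B zero    j = false
  inSupp {suc k} B (suc i) j = isNonzero (B fzero j) ∨ inSupp (λ r → B (fsuc r)) i j

  -- proj B i = π^⊥ of the first i rows of B.  With 0-based row index r
  -- (row r is b_{r+1}), the paper's π_{r+1} is  proj B r.
  proj : ∀ {k n} → Matrix k n → ℕ → Word n → Word n
  proj B i x j = if inSupp B i j then 0# else x j

  ForwardReduced : ∀ {m n} → Matrix (suc m) n → Set (c ⊔ ℓ)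
  ForwardReduced M =
    NonzeroWord (M fzero) ×
    (∀ cs → NonzeroWord (lincomb M cs) → ∣ M fzero ∣ₕ ≤ ∣ lincomb M cs ∣ₕ)

  -- B_[r, r] (one row) and B_[r, s] with s = r + 1 (two rows), 0-based
  block₁ : ∀ {k n} → Matrix k n → Fin k → Matrix 1 n
  block₁ B r _ = proj B (toℕ r) (B r)

  block₂ : ∀ {k n} → Matrix k n → Fin k → Fin k → Matrix 2 n
  block₂ B r s fzero        = proj B (toℕ r) (B r)
  block₂ B r s (fsuc fzero) = proj B (toℕ r) (B s)

  -- LLL-reduced: B_[i,i+1] forward reduced for all i ∈ [1,k], where
  -- B_[k,k+1] := B_[k,k].
  LLLReduced : ∀ {k n} → Matrix k n → Set (c ⊔ ℓ)
  LLLReduced {k} B = ∀ (r : Fin k) →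
    (∀ (s : Fin k) → toℕ s ≡ suc (toℕ r) → ForwardReduced (block₂ B r s)) ×
    (suc (toℕ r) ≡ k → ForwardReduced (block₁ B r))

  ceilSum : ℕ → ℕ → ℕ
  ceilSum w k = sum (map (λ i → ⌈ w / q ^ i ⌉) (upTo k))

-- Write b₁⁺, …, b_k⁺ for the projected rows π_r(b_r).  For consecutive rows,
-- forward reducedness of (x; y) = B_[r,r+1] gives |x| ≤ q·|π⊥_x(y)|: each
-- y − a·x (a ∈ F_q) is nonzero off the support of x, so it has weight at least
-- |x|; hence at most |π⊥_x(y)| coordinates j ∈ supp x satisfy y_j = a·x_j,
-- and every j ∈ supp x satisfies this for exactly one of the q values of a.
-- Iterating, |b₁| ≤ q^r·|b_{r+1}⁺|, i.e. ⌈|b₁|/q^r⌉ ≤ |b_{r+1}⁺|, and the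
-- projected rows have pairwise disjoint supports, so their weights sum to at
-- most n.
module Submission where

open import Defs
open import Level using (Level)
open import Data.Nat using (ℕ; suc; _≥_)
open import Data.Fin using () renaming (zero to fzero)

open import Data.Nat using (zero; _+_; _*_; _≤_; _^_; z≤n; s≤s⁻¹)
open import Data.Nat.Properties hiding (_≟_)
import Data.Nat as ℕ
open import Data.Nat.DivMod using (_/_; m<n*o⇒m/o<n)
import Data.Nat.ListAction as ListAction
open import Data.Fin using (Fin; toℕ; inject₁; fromℕ<) renaming (suc to fsuc)
open import Data.Fin.Properties using (toℕ-inject₁; toℕ<n; toℕ-fromℕ<)
open import Data.Fin.Induction using (<-weakInduction)
open import Data.Bool using (Bool; true; false; _∨_; _∧_; if_then_else_)
open import Data.Bool.Properties using (∨-identityʳ; ∨-assoc)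
open import Data.List using (applyUpTo)
open import Data.List.Properties using (map-upTo)
open import Data.Product using (_,_; proj₁; proj₂; ∃-syntax)
open import Data.Empty using (⊥-elim)
open import Relation.Nullary using (¬_; Dec; yes; no; does)
open import Relation.Binary.PropositionalEquality
  using (_≡_; refl; cong; cong₂; sym; trans; subst)
import Relation.Binary.Reasoning.Setoid
open import Algebra.Properties.CommutativeMonoid.Sum +-0-commutativeMonoid
  using (sum; sum-syntax; ∑-distrib-+; ∑-comm; sum-cong-≗; sum-replicate-zero)

⟦_⟧ : Bool → ℕ
⟦ b ⟧ = if b then 1 else 0

⟦⟧≤1 : ∀ b → ⟦ b ⟧ ≤ 1
⟦⟧≤1 true  = ≤-refl
⟦⟧≤1 false = z≤n

∑-mono-≤ : ∀ {m} {f g : Fin m → ℕ} → (∀ i → f i ≤ g i) → sum f ≤ sum g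
∑-mono-≤ {zero}  f≤g = z≤n
∑-mono-≤ {suc m} f≤g = +-mono-≤ (f≤g fzero) (∑-mono-≤ (λ i → f≤g (fsuc i)))

∑-const : ∀ m c → ∑[ i < m ] c ≡ m * c
∑-const zero    c = refl
∑-const (suc m) c = cong (c +_) (∑-const m c)

term≤∑ : ∀ {m} (f : Fin m → ℕ) i → f i ≤ sum f
term≤∑ f fzero    = m≤m+n _ _
term≤∑ f (fsuc i) = ≤-trans (term≤∑ (λ i → f (fsuc i)) i) (m≤n+m _ _)

sum-applyUpTo : ∀ (f : ℕ → ℕ) m → ListAction.sum (applyUpTo f m) ≡ ∑[ i < m ] f (toℕ i)
sum-applyUpTo f zero    = refl
sum-applyUpTo f (suc m) = cong (f 0 +_) (sum-applyUpTo (λ i → f (suc i)) m)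

m≤n*o⇒⌈m/o⌉≤n : ∀ {m n o} → m ≤ n * o → ⌈ m / o ⌉ ≤ n
m≤n*o⇒⌈m/o⌉≤n {o = zero}  _     = z≤n
m≤n*o⇒⌈m/o⌉≤n {n = n} {o = suc o} m≤n*o = s≤s⁻¹ (m<n*o⇒m/o<n
  (≤-trans (+-mono-≤-< m≤n*o (n<1+n o)) (≤-reflexive (+-comm (n * suc o) (suc o)))))

module CodeWeights {c ℓ q} (F : FiniteField c ℓ q) where
  open FiniteField F
    using (Carrier; _≈_; 0#; 1#; -_; _≟_; enum; enum-surj; inverse; setoid; ring)
    renaming (_+_ to _+F_; _*_ to _*F_)
  open Code F hiding (∑)
  open import Algebra.Properties.Ring ring using (-‿distribˡ-*)
  module F = FiniteField F
  module ≈-Reasoning = Relation.Binary.Reasoning.Setoid setoid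

  isNonzero-≈0 : ∀ {a} → a ≈ 0# → isNonzero a ≡ false
  isNonzero-≈0 {a} a≈0 with a ≟ 0#
  ... | yes _   = refl
  ... | no a≉0 = ⊥-elim (a≉0 a≈0)

  isNonzero-≉0 : ∀ {a} → ¬ a ≈ 0# → isNonzero a ≡ true
  isNonzero-≉0 {a} a≉0 with a ≟ 0#
  ... | yes a≈0 = ⊥-elim (a≉0 a≈0)
  ... | no _    = refl

  isNonzero-0# : isNonzero 0# ≡ false
  isNonzero-0# = isNonzero-≈0 F.refl

  isNonzero-cong : ∀ {a b} → a ≈ b → isNonzero a ≡ isNonzero b
  isNonzero-cong {a} {b} a≈b with b ≟ 0#
  ... | yes b≈0 = isNonzero-≈0 (F.trans a≈b b≈0)
  ... | no b≉0  = isNonzero-≉0 (λ a≈0 → b≉0 (F.trans (F.sym a≈b) a≈0))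

  count≡∑ : ∀ {n} (f : Fin n → Bool) → count f ≡ ∑[ j < n ] ⟦ f j ⟧
  count≡∑ {zero}  f = refl
  count≡∑ {suc n} f = cong (⟦ f fzero ⟧ +_) (count≡∑ (λ j → f (fsuc j)))

  weight≡∑ : ∀ {n} (x : Word n) → ∣ x ∣ₕ ≡ ∑[ j < n ] ⟦ isNonzero (x j) ⟧
  weight≡∑ x = count≡∑ (λ j → isNonzero (x j))

  weight-cong : ∀ {n} {x y : Word n} → (∀ j → x j ≡ y j) → ∣ x ∣ₕ ≡ ∣ y ∣ₕ
  weight-cong {zero}  x≗y = refl
  weight-cong {suc n} x≗y =
    cong₂ _+_ (cong (λ a → ⟦ isNonzero a ⟧) (x≗y fzero)) (weight-cong (λ j → x≗y (fsuc j)))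

  π⊥ : ∀ {n} → Word n → Word n → Word n
  π⊥ x y j = if isNonzero (x j) then 0# else y j

  module _ {n} (M : Matrix 2 n) (reduced : ForwardReduced M) where
    private
      x y : Word n
      x = M fzero
      y = M (fsuc fzero)

      coeffs : Carrier → Fin 2 → Carrier
      coeffs a fzero    = - a
      coeffs a (fsuc _) = 1#

      y-ax : Carrier → Word n
      y-ax a = lincomb M (coeffs a)

      agrees : Carrier → Fin n → ℕ
      agrees a j = ⟦ isNonzero (x j) ∧ does (y j ≟ (a *F x j)) ⟧

      y-ax≈y : ∀ a j → x j ≈ 0# → y-ax a j ≈ y j
      y-ax≈y a j x≈0 = begin
        - a *F x j +F (1# *F y j +F 0#)
          ≈⟨ F.+-cong (F.trans (F.*-congˡ x≈0) (F.zeroʳ _))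
                      (F.trans (F.+-identityʳ _) (F.*-identityˡ _)) ⟩
        0# +F y j  ≈⟨ F.+-identityˡ _ ⟩
        y j        ∎
        where open ≈-Reasoning

      y-ax≈0 : ∀ a j → y j ≈ a *F x j → y-ax a j ≈ 0#
      y-ax≈0 a j y≈ax = begin
        - a *F x j +F (1# *F y j +F 0#)
          ≈⟨ F.+-cong (F.sym (-‿distribˡ-* a (x j)))
                      (F.trans (F.+-identityʳ _) (F.trans (F.*-identityˡ _) y≈ax)) ⟩
        - (a *F x j) +F a *F x j  ≈⟨ F.-‿inverseˡ _ ⟩
        0#                        ∎
        where open ≈-Reasoning

      y-ax-nonzero : NonzeroWord (π⊥ x y) → ∀ a → NonzeroWord (y-ax a)
      y-ax-nonzero (j , π⊥≉0) a with x j ≟ 0#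
      ... | yes x≈0 =
        j , λ y-ax≈0 → π⊥≉0 (F.trans (F.sym (y-ax≈y a j x≈0)) y-ax≈0)
      ... | no x≉0 = ⊥-elim (π⊥≉0 F.refl)

      agrees-pointwise : ∀ a j →
        ⟦ isNonzero (y-ax a j) ⟧ + agrees a j ≤ ⟦ isNonzero (π⊥ x y j) ⟧ + ⟦ isNonzero (x j) ⟧
      agrees-pointwise a j with x j ≟ 0#
      ... | yes x≈0 rewrite isNonzero-cong (y-ax≈y a j x≈0) = ≤-refl
      ... | no x≉0 rewrite isNonzero-0# with y j ≟ (a *F x j)
      ...   | yes y≈ax rewrite isNonzero-≈0 (y-ax≈0 a j y≈ax) = ≤-refl
      ...   | no _ = ≤-trans (≤-reflexive (+-identityʳ _)) (⟦⟧≤1 _)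

      agreements≤ : NonzeroWord (π⊥ x y) → ∀ a → ∑[ j < n ] agrees a j ≤ ∣ π⊥ x y ∣ₕ
      agreements≤ π⊥≢0 a = +-cancelˡ-≤ ∣ x ∣ₕ _ _ (begin
        ∣ x ∣ₕ + sum (agrees a)
          ≤⟨ +-monoˡ-≤ _ (proj₂ reduced (coeffs a) (y-ax-nonzero π⊥≢0 a)) ⟩
        ∣ y-ax a ∣ₕ + sum (agrees a)
          ≡⟨ cong (_+ sum (agrees a)) (weight≡∑ (y-ax a)) ⟩
        ∑[ j < n ] ⟦ isNonzero (y-ax a j) ⟧ + sum (agrees a)
          ≡⟨ ∑-distrib-+ (λ j → ⟦ isNonzero (y-ax a j) ⟧) (agrees a) ⟨
        ∑[ j < n ] (⟦ isNonzero (y-ax a j) ⟧ + agrees a j)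
          ≤⟨ ∑-mono-≤ (agrees-pointwise a) ⟩
        ∑[ j < n ] (⟦ isNonzero (π⊥ x y j) ⟧ + ⟦ isNonzero (x j) ⟧)
          ≡⟨ ∑-distrib-+ (λ j → ⟦ isNonzero (π⊥ x y j) ⟧) (λ j → ⟦ isNonzero (x j) ⟧) ⟩
        ∑[ j < n ] ⟦ isNonzero (π⊥ x y j) ⟧ + ∑[ j < n ] ⟦ isNonzero (x j) ⟧
          ≡⟨ cong₂ _+_ (weight≡∑ (π⊥ x y)) (weight≡∑ x) ⟨
        ∣ π⊥ x y ∣ₕ + ∣ x ∣ₕ
          ≡⟨ +-comm ∣ π⊥ x y ∣ₕ ∣ x ∣ₕ ⟩
        ∣ x ∣ₕ + ∣ π⊥ x y ∣ₕ ∎)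
        where open ≤-Reasoning

      agrees-at : ∀ {a j} → ¬ x j ≈ 0# → y j ≈ a *F x j → ⟦ isNonzero (x j) ⟧ ≤ agrees a j
      agrees-at {a} {j} x≉0 y≈ax rewrite isNonzero-≉0 x≉0 with y j ≟ (a *F x j)
      ... | yes _    = ≤-refl
      ... | no y≉ax = ⊥-elim (y≉ax y≈ax)

      ratio-enumerated : ∀ j → ¬ x j ≈ 0# → ∃[ i ] y j ≈ enum i *F x j
      ratio-enumerated j x≉0 = i , F.sym (begin
        enum i *F x j          ≈⟨ F.*-congʳ enum-i≈y/x ⟩
        (y j *F x⁻¹) *F x j    ≈⟨ F.*-assoc _ _ _ ⟩
        y j *F (x⁻¹ *F x j)    ≈⟨ F.*-congˡ (F.*-comm x⁻¹ (x j)) ⟩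
        y j *F (x j *F x⁻¹)    ≈⟨ F.*-congˡ x*x⁻¹≈1 ⟩
        y j *F 1#              ≈⟨ F.*-identityʳ _ ⟩
        y j                    ∎)
        where
        open ≈-Reasoning
        x⁻¹ = proj₁ (inverse (x j) x≉0)
        x*x⁻¹≈1 = proj₂ (inverse (x j) x≉0)
        i = proj₁ (enum-surj (y j *F x⁻¹))
        enum-i≈y/x = proj₂ (enum-surj (y j *F x⁻¹))

      supp-covered : ∀ j → ⟦ isNonzero (x j) ⟧ ≤ ∑[ i < q ] agrees (enum i) j
      supp-covered j = covered (x j ≟ 0#)
        where
        covered : Dec (x j ≈ 0#) → ⟦ isNonzero (x j) ⟧ ≤ ∑[ i < q ] agrees (enum i) j
        covered (yes x≈0) rewrite isNonzero-≈0 x≈0 = z≤n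
        covered (no x≉0) with i , y≈ax ← ratio-enumerated j x≉0 =
          ≤-trans (agrees-at x≉0 y≈ax) (term≤∑ (λ i → agrees (enum i) j) i)

    forwardReduced⇒∣x∣≤q*∣π⊥xy∣ : NonzeroWord (π⊥ x y) → ∣ x ∣ₕ ≤ q * ∣ π⊥ x y ∣ₕ
    forwardReduced⇒∣x∣≤q*∣π⊥xy∣ π⊥≢0 = begin
      ∣ x ∣ₕ                                   ≡⟨ weight≡∑ x ⟩
      ∑[ j < n ] ⟦ isNonzero (x j) ⟧           ≤⟨ ∑-mono-≤ supp-covered ⟩
      ∑[ j < n ] ∑[ i < q ] agrees (enum i) j  ≡⟨ ∑-comm (λ i j → agrees (enum i) j) ⟨
      ∑[ i < q ] ∑[ j < n ] agrees (enum i) j  ≤⟨ ∑-mono-≤ (λ i → agreements≤ π⊥≢0 (enum i)) ⟩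
      ∑[ i < q ] ∣ π⊥ x y ∣ₕ                   ≡⟨ ∑-const q _ ⟩
      q * ∣ π⊥ x y ∣ₕ                          ∎
      where open ≤-Reasoning

  inSupp-zero : ∀ {k n} (B : Matrix k n) j → inSupp B 0 j ≡ false
  inSupp-zero {zero}  B j = refl
  inSupp-zero {suc k} B j = refl

  inSupp-suc : ∀ {k n} (B : Matrix k n) (r : Fin k) j →
    inSupp B (suc (toℕ r)) j ≡ inSupp B (toℕ r) j ∨ isNonzero (B r j)
  inSupp-suc {suc k} B fzero    j rewrite inSupp-zero (λ r → B (fsuc r)) j =
    ∨-identityʳ (isNonzero (B fzero j))
  inSupp-suc {suc k} B (fsuc r) j rewrite inSupp-suc (λ r → B (fsuc r)) r j =
    sym (∨-assoc (isNonzero (B fzero j)) _ _)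

  proj-suc : ∀ {k n} (B : Matrix k n) (r s : Fin k) → toℕ s ≡ suc (toℕ r) → ∀ x j →
    proj B (toℕ s) x j ≡ π⊥ (proj B (toℕ r) (B r)) (proj B (toℕ r) x) j
  proj-suc B r s s≡r+1 x j rewrite s≡r+1 | inSupp-suc B r j with inSupp B (toℕ r) j
  ... | true rewrite isNonzero-0# = refl
  ... | false = refl

  supports-disjoint : ∀ {k n} (B : Matrix k n) j →
    ∑[ r < k ] ⟦ isNonzero (proj B (toℕ r) (B r) j) ⟧ ≤ 1
  supports-disjoint {zero}  B j = z≤n
  supports-disjoint {suc k} B j with isNonzero (B fzero j)
  ... | true rewrite isNonzero-0# = ≤-reflexive (cong suc (sum-replicate-zero k))
  ... | false = supports-disjoint (λ r → B (fsuc r)) j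

  ∑-weight-proj≤ : ∀ {k n} (B : Matrix k n) → ∑[ r < k ] ∣ proj B (toℕ r) (B r) ∣ₕ ≤ n
  ∑-weight-proj≤ {k} {n} B = begin
    ∑[ r < k ] ∣ proj B (toℕ r) (B r) ∣ₕ
      ≡⟨ sum-cong-≗ (λ r → weight≡∑ (proj B (toℕ r) (B r))) ⟩
    ∑[ r < k ] ∑[ j < n ] nonzero r j  ≡⟨ ∑-comm nonzero ⟩
    ∑[ j < n ] ∑[ r < k ] nonzero r j  ≤⟨ ∑-mono-≤ (supports-disjoint B) ⟩
    ∑[ j < n ] 1                       ≡⟨ ∑-const n 1 ⟩
    n * 1                              ≡⟨ *-identityʳ n ⟩
    n                                  ∎
    where
    open ≤-Reasoning
    nonzero : Fin k → Fin n → ℕ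
    nonzero r j = ⟦ isNonzero (proj B (toℕ r) (B r) j) ⟧

  ceilSum≡∑ : ∀ w k → ceilSum w k ≡ ∑[ i < k ] ⌈ w / q ^ toℕ i ⌉
  ceilSum≡∑ w k = trans (cong ListAction.sum (map-upTo _ k)) (sum-applyUpTo _ k)

  module _ {k n} (B : Matrix (suc k) n) (lll : LLLReduced B) where

    weight⁺ : Fin (suc k) → ℕ
    weight⁺ r = ∣ proj B (toℕ r) (B r) ∣ₕ

    projected-nonzero : ∀ r → NonzeroWord (proj B (toℕ r) (B r))
    projected-nonzero r with suc (toℕ r) ℕ.≟ suc k
    ... | yes last = proj₁ (proj₂ (lll r) last)
    ... | no ¬last = proj₁ (proj₁ (lll r) (fromℕ< r+1<) (toℕ-fromℕ< r+1<))
      where r+1< = ≤∧≢⇒< (toℕ<n r) ¬last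

    weight⁺-step : ∀ r s → toℕ s ≡ suc (toℕ r) → weight⁺ r ≤ q * weight⁺ s
    weight⁺-step r s s≡r+1 = begin
      weight⁺ r
        ≤⟨ forwardReduced⇒∣x∣≤q*∣π⊥xy∣ (block₂ B r s) (proj₁ (lll r) s s≡r+1) π⊥≢0 ⟩
      q * ∣ π⊥ (proj B (toℕ r) (B r)) (proj B (toℕ r) (B s)) ∣ₕ
        ≡⟨ cong (q *_) (weight-cong (λ j → sym (proj-suc B r s s≡r+1 (B s) j))) ⟩
      q * weight⁺ s ∎
      where
      open ≤-Reasoning
      π⊥≢0 : NonzeroWord (π⊥ (proj B (toℕ r) (B r)) (proj B (toℕ r) (B s)))
      π⊥≢0 with projected-nonzero s
      ... | j , ≉0 = j , subst (λ a → ¬ a ≈ 0#) (proj-suc B r s s≡r+1 (B s) j) ≉0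

    ∣b₁∣≤weight⁺*q^ : ∀ r → ∣ B fzero ∣ₕ ≤ weight⁺ r * q ^ toℕ r
    ∣b₁∣≤weight⁺*q^ = <-weakInduction P (≤-reflexive (sym (*-identityʳ _))) step
      where
      -- the base case holds because π₁ = proj B 0 is definitionally the identity
      P : Fin (suc k) → Set
      P r = ∣ B fzero ∣ₕ ≤ weight⁺ r * q ^ toℕ r

      step : ∀ i → P (inject₁ i) → P (fsuc i)
      step i ih = begin
        ∣ B fzero ∣ₕ                            ≤⟨ ih ⟩
        weight⁺ (inject₁ i) * q ^ toℕ (inject₁ i)
          ≡⟨ cong (λ t → weight⁺ (inject₁ i) * q ^ t) (toℕ-inject₁ i) ⟩
        weight⁺ (inject₁ i) * q ^ toℕ i
          ≤⟨ *-monoˡ-≤ (q ^ toℕ i)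
               (weight⁺-step (inject₁ i) (fsuc i) (cong suc (sym (toℕ-inject₁ i)))) ⟩
        q * weight⁺ (fsuc i) * q ^ toℕ i
          ≡⟨ cong (_* q ^ toℕ i) (*-comm q _) ⟩
        weight⁺ (fsuc i) * q * q ^ toℕ i        ≡⟨ *-assoc (weight⁺ (fsuc i)) q _ ⟩
        weight⁺ (fsuc i) * q ^ suc (toℕ i)      ∎
        where open ≤-Reasoning

mainTheorem14 : ∀ {c ℓ : Level} {q : ℕ} (F : FiniteField c ℓ q) (k n : ℕ)
    (B : Code.Matrix F (suc k) n) →
    Code.LinIndep F B → Code.LLLReduced F B →
    n ≥ Code.ceilSum F (Code.∣_∣ₕ F (B fzero)) (suc k)
mainTheorem14 {q = q} F k n B _ lll = begin
  ceilSum ∣ B fzero ∣ₕ (suc k)                   ≡⟨ ceilSum≡∑ _ (suc k) ⟩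
  ∑[ r < suc k ] ⌈ ∣ B fzero ∣ₕ / q ^ toℕ r ⌉
    ≤⟨ ∑-mono-≤ {g = weight⁺ B lll} (λ r → m≤n*o⇒⌈m/o⌉≤n (∣b₁∣≤weight⁺*q^ B lll r)) ⟩
  ∑[ r < suc k ] weight⁺ B lll r                 ≤⟨ ∑-weight-proj≤ B ⟩
  n                                              ∎
  where
  open ≤-Reasoning
  open Code F using (ceilSum; ∣_∣ₕ)
  open CodeWeights F
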